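{- Let $n$ be odd. Then there exists $p_0$ with $0<p_0<1$ such that $W_2(p)\ge 0.5$ for all $p\in[p_0,1]$, where $W_2(p)$ is the probability that the Erdős–Rényi random graph $\mathcal{G}(n,p)$ is a $\mathcal{P}$ position of Grim.
   Context: Grim: two players alternate moves on a finite simple undirected graph. Before play, isolated vertices are deleted. A move consists of choosing a remaining vertex and deleting it together with its incident edges, and then deleting every vertex that has become isolated. The player making the last move wins (a player with no available move loses). A graph is an $\mathcal{N}$ position if the player about to move has a winning strategy, and a $\mathcal{P}$ position otherwise; the graph with no edges is a $\mathcal{P}$ position. The Erdős–Rényi random graph $\mathcal{G}(n,p)$ has vertex set $\{1,\dots,n\}$, each of the $\binom n2$ possible edges being present independently with probability $p$; thus $W_2(p)=\sum_{\mathcal{G}} p^{k(\mathcal{G})}(1-p)^{\binom n2-k(\mathcal{G})}$, the sum over all graphs $\mathcal{G}$ on $\{1,\dots,n\}$ that are $\mathcal{P}$ positions, with $k(\mathcal{G})$ the number of edges.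
   Formalization: The probability $p$ ranges only over the rationals in $[p_0,1]$, and the threshold $p_0$ is taken in the rationals. -}

module Defs where

open import Data.Nat using (ℕ; zero; suc; _∸_)
open import Data.Bool using (Bool; true; false; not; if_then_else_; _∨_)
open import Data.Bool.Properties using (T?)
open import Data.Bool.ListAction using (any)
open import Data.Fin using (Fin; toℕ) renaming (_≟_ to _≟ᶠ_)
open import Data.Fin using () renaming (_<?_ to _<ᶠ?_)
open import Data.List using (List; []; _∷_; length; filter; map; _++_; concatMap; foldr)
open import Data.List.Base using (allFin)
open import Data.Product using (_×_; _,_; proj₁; proj₂)
open import Relation.Nullary.Decidable using (⌊_⌋; does)
open import Data.Rational using (ℚ; 0ℚ; 1ℚ; _+_; _*_; _-_)

-- An edge of a simple graph on {0,…,n-1}: an unordered pair, stored as (i , j) with i < j.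
Edge : ℕ → Set
Edge n = Fin n × Fin n

allEdges : (n : ℕ) → List (Edge n)
allEdges n = concatMap (λ i → map (λ j → (i , j)) (filter (λ j → i <ᶠ? j) (allFin n))) (allFin n)

-- Since isolated vertices are deleted in Grim, a Grim position is determined
-- by its edge set: the remaining vertices are exactly the endpoints of edges.
Graph : ℕ → Set
Graph n = List (Edge n)

sublists : {A : Set} → List A → List (List A)
sublists []       = [] ∷ []
sublists (x ∷ xs) = let r = sublists xs in map (x ∷_) r ++ r

allGraphs : (n : ℕ) → List (Graph n)
allGraphs n = sublists (allEdges n)

incident : {n : ℕ} → Fin n → Edge n → Bool
incident v (i , j) = does (v ≟ᶠ i) ∨ does (v ≟ᶠ j)

-- Grim move at v: delete v and its incident edges; vertices that become
-- isolated disappear automatically (they are no longer endpoints of any edge).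
move : {n : ℕ} → Fin n → Graph n → Graph n
move v G = filter (λ e → T? (not (incident v e))) G

-- vertices of the position (endpoints of edges; may contain repetitions)
vertices : {n : ℕ} → Graph n → List (Fin n)
vertices G = concatMap (λ e → proj₁ e ∷ proj₂ e ∷ []) G

-- isNWith k G : the player to move wins, computed with recursion depth k.
-- Every move deletes at least one edge, so depth = number of edges suffices.
isNWith : {n : ℕ} → ℕ → Graph n → Bool
isNWith zero    G = false
isNWith (suc k) G = any (λ v → not (isNWith k (move v G))) (vertices G)

isN : {n : ℕ} → Graph n → Bool
isN G = isNWith (length G) G

isP : {n : ℕ} → Graph n → Bool
isP G = not (isN G)

_^ℚ_ : ℚ → ℕ → ℚ
x ^ℚ zero  = 1ℚ
x ^ℚ suc k = x * (x ^ℚ k)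

numPairs : ℕ → ℕ
numPairs n = length (allEdges n)

weight : (n : ℕ) → ℚ → Graph n → ℚ
weight n p G = (p ^ℚ length G) * ((1ℚ - p) ^ℚ (numPairs n ∸ length G))

W₂ : (n : ℕ) → ℚ → ℚ
W₂ n p = foldr _+_ 0ℚ (map (λ G → if isP G then weight n p G else 0ℚ) (allGraphs n))

-- The complete graph Kₙ is a 𝓟 position for odd n: a move in a complete graph on m ≥ 2
-- vertices deletes one vertex and leaves the complete graph on m - 1 vertices, while
-- K₁ has no edges, so the player to move from Kₘ wins exactly when m ≥ 2 is even.
-- Hence W₂(p) is at least the probability p^(n choose 2) that 𝓖(n,p) is complete, and
-- by Bernoulli's inequality p^N ≥ 1 - N(1 - p) ≥ ½ once 1 - p ≤ 1/(2N + 2).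
module Submission where

open import Defs
open import Data.Bool using (Bool; true; false; not; T; if_then_else_)
open import Data.Bool.Properties using (T?; ∨-idem; ∨-identityʳ; not-involutive)
open import Data.Bool.ListAction using (any)
open import Data.Empty using (⊥-elim)
open import Data.Fin using (Fin) renaming (_≟_ to _≟ᶠ_; _<_ to _<ᶠ_; _<?_ to _<ᶠ?_)
open import Data.Fin.Properties using (<-cmp; <⇒≢)
open import Data.List using (List; []; _∷_; length; filter; map; foldr; allFin)
open import Data.List.Membership.Propositional using (_∈_; find; lose)
open import Data.List.Membership.Propositional.Properties
  using (∈-filter⁺; ∈-filter⁻; ∈-concatMap⁺; ∈-concatMap⁻; ∈-map⁺; ∈-map⁻; ∈-allFin; ∈-++⁺ˡ)
open import Data.List.Properties using (filter-notAll; filter-all; filter-reject; length-tabulate)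
open import Data.List.Relation.Unary.All as All using (All; []; _∷_)
open import Data.List.Relation.Unary.AllPairs using (_∷_)
open import Data.List.Relation.Unary.Any using (here; there)
open import Data.List.Relation.Unary.Unique.Propositional using (Unique)
open import Data.List.Relation.Unary.Unique.Propositional.Properties using (allFin⁺; filter⁺)
open import Data.Nat using (ℕ; zero; suc; _%_; _∸_; z≤n; s≤s; s≤s⁻¹) renaming (_≤_ to _≤ℕ_; _<_ to _<ℕ_)
open import Data.Nat.Properties using (n∸n≡0) renaming (≤-refl to ≤ℕ-refl; ≤-trans to ≤ℕ-trans)
open import Data.Product using (Σ; Σ-syntax; _×_; _,_; proj₁; proj₂)
open import Data.Rational
  using (ℚ; 0ℚ; 1ℚ; ½; _<_; _≤_; _+_; _*_; _-_; 1/_; Positive; NonZero; nonNegative; nonPositive)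
open import Data.Rational.Properties
  using ( ≤-refl; ≤-reflexive; ≤-trans; <-≤-trans; ≤-total; <⇒≤; module ≤-Reasoning
        ; +-identityˡ; +-identityʳ; *-identityʳ; *-zeroˡ; *-inverseʳ
        ; +-mono-≤; +-monoˡ-≤; +-monoʳ-≤; +-monoʳ-<; neg-antimono-≤; neg-antimono-<; *-monoˡ-≤-nonNeg
        ; nonNegative⁻¹; positive⁻¹; pos⇒nonZero; 1/pos⇒pos
        ; pos+nonNeg⇒pos; pos*pos⇒pos; nonNeg*nonNeg⇒nonNeg; nonPos*nonPos⇒nonPos )
open import Data.Rational.Solver using (module +-*-Solver)
open import Data.Sum using (_⊎_; inj₁; inj₂; [_,_]′)
open import Function using (id; _∘_)
open import Relation.Binary using (tri<; tri≈; tri>)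
open import Relation.Binary.PropositionalEquality
  using (_≡_; _≢_; refl; sym; trans; cong; subst; ≢-sym; module ≡-Reasoning)
open import Relation.Nullary using (¬_; ¬?; yes; no)

any-constant : ∀ {A : Set} {b} (f : A → Bool) {x xs} → All (λ y → f y ≡ b) (x ∷ xs) → any f (x ∷ xs) ≡ b
any-constant {b = b} f (fx≡b ∷ [])         rewrite fx≡b = ∨-identityʳ b
any-constant {b = b} f (fx≡b ∷ fy≡b ∷ rest) rewrite fx≡b | any-constant f (fy≡b ∷ rest) = ∨-idem b

cliqueIsN : ℕ → Bool
cliqueIsN zero          = false
cliqueIsN (suc zero)    = false
cliqueIsN (suc (suc m)) = not (cliqueIsN (suc m))

cliqueIsN-odd : ∀ m → m % 2 ≡ 1 → cliqueIsN m ≡ false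
cliqueIsN-odd (suc zero)          _   = refl
cliqueIsN-odd (suc (suc (suc m))) odd = trans (not-involutive _) (cliqueIsN-odd (suc m) odd)

cliqueIsN-suc : ∀ {m} → 1 ≤ℕ m → cliqueIsN (suc m) ≡ not (cliqueIsN m)
cliqueIsN-suc {suc m} _ = refl

module _ {n : ℕ} where

  record CompleteOn (S : List (Fin n)) (G : Graph n) : Set where
    field
      unique   : Unique S
      sound    : ∀ {e} → e ∈ G → proj₁ e ∈ S × proj₂ e ∈ S × proj₁ e ≢ proj₂ e
      complete : ∀ {a b} → a ∈ S → b ∈ S → a ≢ b → (a , b) ∈ G ⊎ (b , a) ∈ G
  open CompleteOn

  remove : Fin n → List (Fin n) → List (Fin n)
  remove v = filter (λ x → ¬? (x ≟ᶠ v))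

  length-remove : ∀ {v S} → Unique S → v ∈ S → length S ≡ suc (length (remove v S))
  length-remove {v} {v ∷ S} (v∉S ∷ _) (here refl) = cong suc (cong length (sym (begin
    remove v (v ∷ S) ≡⟨ filter-reject (λ x → ¬? (x ≟ᶠ v)) (λ v≢v → v≢v refl) ⟩
    remove v S       ≡⟨ filter-all (λ x → ¬? (x ≟ᶠ v)) (All.map ≢-sym v∉S) ⟩
    S                ∎)))
    where open ≡-Reasoning
  length-remove {v} {x ∷ S} (x∉S ∷ uniqueS) (there v∈S) with x ≟ᶠ v
  ... | yes refl = ⊥-elim (All.lookup x∉S v∈S refl)
  ... | no _     = cong suc (length-remove uniqueS v∈S)

  ∉-incident⁻ : ∀ {v : Fin n} (e : Edge n) → T (not (incident v e)) → v ≢ proj₁ e × v ≢ proj₂ e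
  ∉-incident⁻ {v} (i , j) v∉e with v ≟ᶠ i | v ≟ᶠ j
  ... | no v≢i | no v≢j = v≢i , v≢j

  ∉-incident⁺ : ∀ {v : Fin n} (e : Edge n) → v ≢ proj₁ e → v ≢ proj₂ e → T (not (incident v e))
  ∉-incident⁺ {v} (i , j) v≢i v≢j with v ≟ᶠ i | v ≟ᶠ j
  ... | yes v≡i | _       = v≢i v≡i
  ... | no _    | yes v≡j = v≢j v≡j
  ... | no _    | no _    = _

  ∈-move⁻ : ∀ {v : Fin n} {e G} → e ∈ move v G → e ∈ G × v ≢ proj₁ e × v ≢ proj₂ e
  ∈-move⁻ {v} {e} e∈vG with e∈G , v∉e ← ∈-filter⁻ (λ (e : Edge n) → T? (not (incident v e))) e∈vG =
    e∈G , ∉-incident⁻ e v∉e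

  ∈-move⁺ : ∀ {v : Fin n} {e G} → e ∈ G → v ≢ proj₁ e → v ≢ proj₂ e → e ∈ move v G
  ∈-move⁺ {v} {e} e∈G v≢i v≢j =
    ∈-filter⁺ (λ (e : Edge n) → T? (not (incident v e))) e∈G (∉-incident⁺ e v≢i v≢j)

  ∈-remove⁻ : ∀ {v x S} → x ∈ remove v S → x ∈ S × x ≢ v
  ∈-remove⁻ {v} = ∈-filter⁻ (λ x → ¬? (x ≟ᶠ v))

  ∈-remove⁺ : ∀ {v x S} → x ∈ S → x ≢ v → x ∈ remove v S
  ∈-remove⁺ {v} = ∈-filter⁺ (λ x → ¬? (x ≟ᶠ v))

  ∈-vertices⁻ : ∀ {v : Fin n} G → v ∈ vertices G → Σ[ e ∈ Edge n ] e ∈ G × (v ≡ proj₁ e ⊎ v ≡ proj₂ e)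
  ∈-vertices⁻ (e ∷ G) (here v≡i)         = e , here refl , inj₁ v≡i
  ∈-vertices⁻ (e ∷ G) (there (here v≡j)) = e , here refl , inj₂ v≡j
  ∈-vertices⁻ (e ∷ G) (there (there v∈G)) with e′ , e′∈G , v∈e′ ← ∈-vertices⁻ G v∈G =
    e′ , there e′∈G , v∈e′

  move-shrinks : ∀ {v : Fin n} G → v ∈ vertices G → length (move v G) <ℕ length G
  move-shrinks {v} G v∈G with e , e∈G , v∈e ← ∈-vertices⁻ G v∈G =
    filter-notAll (λ (e : Edge n) → T? (not (incident v e))) G (lose e∈G v-incident)
    where
    v-incident : ¬ T (not (incident v e))
    v-incident v∉e with v≢i , v≢j ← ∉-incident⁻ e v∉e = [ v≢i , v≢j ]′ v∈e

  vertices⊆ : ∀ {S G v} → CompleteOn S G → v ∈ vertices G → v ∈ S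
  vertices⊆ {G = G} K v∈G with ∈-vertices⁻ G v∈G
  ... | e , e∈G , v∈e with sound K e∈G | v∈e
  ... | i∈S , _   , _ | inj₁ refl = i∈S
  ... | _   , j∈S , _ | inj₂ refl = j∈S

  edge⇒2≤length : ∀ {S G e} → CompleteOn S G → e ∈ G → 2 ≤ℕ length S
  edge⇒2≤length {[]}         K e∈G with () ← sound K e∈G
  edge⇒2≤length {_ ∷ []}     K e∈G with here i≡x , here j≡x , i≢j ← sound K e∈G =
    ⊥-elim (i≢j (trans i≡x (sym j≡x)))
  edge⇒2≤length {_ ∷ _ ∷ _}  K e∈G = s≤s (s≤s z≤n)

  move-completeOn : ∀ {S G v} → CompleteOn S G → CompleteOn (remove v S) (move v G)
  move-completeOn {S} {G} {v} K = record
    { unique   = filter⁺ (λ x → ¬? (x ≟ᶠ v)) (unique K)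
    ; sound    = sound′
    ; complete = complete′
    }
    where
    sound′ : ∀ {e} → e ∈ move v G → proj₁ e ∈ remove v S × proj₂ e ∈ remove v S × proj₁ e ≢ proj₂ e
    sound′ {e} e∈vG with e∈G , v≢i , v≢j ← ∈-move⁻ e∈vG with i∈S , j∈S , i≢j ← sound K e∈G =
      ∈-remove⁺ i∈S (≢-sym v≢i) , ∈-remove⁺ j∈S (≢-sym v≢j) , i≢j
    complete′ : ∀ {a b} → a ∈ remove v S → b ∈ remove v S → a ≢ b → (a , b) ∈ move v G ⊎ (b , a) ∈ move v G
    complete′ a∈vS b∈vS a≢b with a∈S , a≢v ← ∈-remove⁻ a∈vS with b∈S , b≢v ← ∈-remove⁻ b∈vS
      with complete K a∈S b∈S a≢b
    ... | inj₁ ab∈G = inj₁ (∈-move⁺ ab∈G (≢-sym a≢v) (≢-sym b≢v))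
    ... | inj₂ ba∈G = inj₂ (∈-move⁺ ba∈G (≢-sym b≢v) (≢-sym a≢v))

  isNWith-[] : ∀ k → isNWith {n} k [] ≡ false
  isNWith-[] zero    = refl
  isNWith-[] (suc k) = refl

  cliqueIsN-edgeless : ∀ {S} → CompleteOn S [] → cliqueIsN (length S) ≡ false
  cliqueIsN-edgeless {[]}        _ = refl
  cliqueIsN-edgeless {_ ∷ []}    _ = refl
  cliqueIsN-edgeless {_ ∷ _ ∷ _} K with (a≢b ∷ _) ∷ _ ← unique K
    with complete K (here refl) (there (here refl)) a≢b
  ... | inj₁ ()
  ... | inj₂ ()

  isNWith-completeOn : ∀ k S (G : Graph n) → CompleteOn S G → length G ≤ℕ k →
                       isNWith k G ≡ cliqueIsN (length S)
  isNWith-completeOn k       S []      K _          = trans (isNWith-[] k) (sym (cliqueIsN-edgeless K))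
  isNWith-completeOn (suc k) S (e ∷ G) K (s≤s |G|≤k) = any-constant _ (All.tabulate move-flips)
    where
    open ≡-Reasoning
    move-flips : ∀ {v} → v ∈ vertices (e ∷ G) → not (isNWith k (move v (e ∷ G))) ≡ cliqueIsN (length S)
    move-flips {v} v∈G = begin
      not (isNWith k (move v (e ∷ G)))      ≡⟨ cong not (isNWith-completeOn k _ _ (move-completeOn K) |vG|≤k) ⟩
      not (cliqueIsN (length (remove v S))) ≡⟨ sym (cliqueIsN-suc 1≤|vS|) ⟩
      cliqueIsN (suc (length (remove v S))) ≡⟨ cong cliqueIsN (sym |S|≡) ⟩
      cliqueIsN (length S)                  ∎
      where
      |vG|≤k : length (move v (e ∷ G)) ≤ℕ k
      |vG|≤k = ≤ℕ-trans (s≤s⁻¹ (move-shrinks (e ∷ G) v∈G)) |G|≤k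
      |S|≡ : length S ≡ suc (length (remove v S))
      |S|≡ = length-remove (unique K) (vertices⊆ K v∈G)
      1≤|vS| : 1 ≤ℕ length (remove v S)
      1≤|vS| = s≤s⁻¹ (subst (2 ≤ℕ_) |S|≡ (edge⇒2≤length K (here refl)))

  ∈-allEdges⁻ : ∀ {e} → e ∈ allEdges n → proj₁ e <ᶠ proj₂ e
  ∈-allEdges⁻ e∈ with i , _ , e∈i ← find (∈-concatMap⁻ _ {xs = allFin n} e∈)
    with j , j∈ , refl ← ∈-map⁻ (i ,_) e∈i = proj₂ (∈-filter⁻ (i <ᶠ?_) {xs = allFin n} j∈)

  ∈-allEdges⁺ : ∀ {i j} → i <ᶠ j → (i , j) ∈ allEdges n
  ∈-allEdges⁺ {i} {j} i<j =
    ∈-concatMap⁺ _ (lose (∈-allFin i) (∈-map⁺ (i ,_) (∈-filter⁺ (i <ᶠ?_) (∈-allFin j) i<j)))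

  allEdges-completeOn : CompleteOn (allFin n) (allEdges n)
  allEdges-completeOn = record
    { unique   = allFin⁺ n
    ; sound    = λ e∈ → ∈-allFin _ , ∈-allFin _ , <⇒≢ (∈-allEdges⁻ e∈)
    ; complete = complete′
    }
    where
    complete′ : ∀ {a b} → a ∈ allFin n → b ∈ allFin n → a ≢ b → (a , b) ∈ allEdges n ⊎ (b , a) ∈ allEdges n
    complete′ {a} {b} _ _ a≢b with <-cmp a b
    ... | tri< a<b _   _   = inj₁ (∈-allEdges⁺ a<b)
    ... | tri≈ _   a≡b _   = ⊥-elim (a≢b a≡b)
    ... | tri> _   _   b<a = inj₂ (∈-allEdges⁺ b<a)

isP-allEdges : ∀ n → n % 2 ≡ 1 → isP (allEdges n) ≡ true
isP-allEdges n odd = cong not (begin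
  isN (allEdges n)                ≡⟨ isNWith-completeOn _ _ _ (allEdges-completeOn {n}) ≤ℕ-refl ⟩
  cliqueIsN (length (allFin n))   ≡⟨ cong cliqueIsN (length-tabulate {n = n} id) ⟩
  cliqueIsN n                     ≡⟨ cliqueIsN-odd n odd ⟩
  false                           ∎)
  where open ≡-Reasoning

fromℕ : ℕ → ℚ
fromℕ zero    = 0ℚ
fromℕ (suc k) = 1ℚ + fromℕ k

p≤p+q : ∀ {p q} → 0ℚ ≤ q → p ≤ p + q
p≤p+q {p} 0≤q = subst (_≤ p + _) (+-identityʳ p) (+-monoʳ-≤ p 0≤q)

p≤q+p : ∀ {p q} → 0ℚ ≤ q → p ≤ q + p
p≤q+p {p} {q} 0≤q = subst (_≤ q + p) (+-identityˡ p) (+-monoˡ-≤ p 0≤q)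

-antimonoʳ-≤ : ∀ r {p q} → p ≤ q → r - q ≤ r - p
-antimonoʳ-≤ r p≤q = +-monoʳ-≤ r (neg-antimono-≤ p≤q)

*-nonNeg : ∀ {p q} → 0ℚ ≤ p → 0ℚ ≤ q → 0ℚ ≤ p * q
*-nonNeg {p} {q} 0≤p 0≤q = nonNegative⁻¹ _ {{nonNeg*nonNeg⇒nonNeg p {{nonNegative 0≤p}} q {{nonNegative 0≤q}}}}

*-self-nonNeg : ∀ p → 0ℚ ≤ p * p
*-self-nonNeg p with ≤-total 0ℚ p
... | inj₁ 0≤p = *-nonNeg 0≤p 0≤p
... | inj₂ p≤0 = nonNegative⁻¹ _ {{nonPos*nonPos⇒nonPos p {{nonPositive p≤0}} p {{nonPositive p≤0}}}}

fromℕ-nonNeg : ∀ k → 0ℚ ≤ fromℕ k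
fromℕ-nonNeg zero    = ≤-refl
fromℕ-nonNeg (suc k) = +-mono-≤ (nonNegative⁻¹ 1ℚ) (fromℕ-nonNeg k)

^ℚ-nonNeg : ∀ k {x} → 0ℚ ≤ x → 0ℚ ≤ x ^ℚ k
^ℚ-nonNeg zero    _   = nonNegative⁻¹ 1ℚ
^ℚ-nonNeg (suc k) 0≤x = *-nonNeg 0≤x (^ℚ-nonNeg k 0≤x)

bernoulli : ∀ k {x} → 0ℚ ≤ x → 1ℚ - fromℕ k * (1ℚ - x) ≤ x ^ℚ k
bernoulli zero    {x} _   = ≤-reflexive (cong (1ℚ -_) (*-zeroˡ (1ℚ - x)))
bernoulli (suc k) {x} 0≤x = begin
  1ℚ - (1ℚ + K) * (1ℚ - x)                             ≤⟨ p≤p+q (*-nonNeg (fromℕ-nonNeg k) (*-self-nonNeg (1ℚ - x))) ⟩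
  1ℚ - (1ℚ + K) * (1ℚ - x) + K * ((1ℚ - x) * (1ℚ - x)) ≡⟨ expand ⟩
  x * (1ℚ - K * (1ℚ - x))                              ≤⟨ *-monoˡ-≤-nonNeg x {{nonNegative 0≤x}} (bernoulli k 0≤x) ⟩
  x * x ^ℚ k                                           ∎
  where
  open ≤-Reasoning
  open +-*-Solver
  K = fromℕ k
  expand : 1ℚ - (1ℚ + K) * (1ℚ - x) + K * ((1ℚ - x) * (1ℚ - x)) ≡ x * (1ℚ - K * (1ℚ - x))
  expand = solve 2 (λ x K → con 1ℚ :- (con 1ℚ :+ K) :* (con 1ℚ :- x) :+ K :* ((con 1ℚ :- x) :* (con 1ℚ :- x))
                          := x :* (con 1ℚ :- K :* (con 1ℚ :- x))) refl x K

½≤^ℚ : ∀ N {δ p} → fromℕ N * δ ≤ ½ → 0ℚ ≤ p → 1ℚ - δ ≤ p → ½ ≤ p ^ℚ N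
½≤^ℚ N {δ} {p} Nδ≤½ 0≤p 1-δ≤p = begin
  ½                       ≡⟨⟩
  1ℚ - ½                  ≤⟨ -antimonoʳ-≤ 1ℚ Nδ≤½ ⟩
  1ℚ - fromℕ N * δ        ≤⟨ -antimonoʳ-≤ 1ℚ (*-monoˡ-≤-nonNeg (fromℕ N) {{nonNegative (fromℕ-nonNeg N)}} 1-p≤δ) ⟩
  1ℚ - fromℕ N * (1ℚ - p) ≤⟨ bernoulli N 0≤p ⟩
  p ^ℚ N                  ∎
  where
  open ≤-Reasoning
  open +-*-Solver
  1-p≤δ : 1ℚ - p ≤ δ
  1-p≤δ = subst (1ℚ - p ≤_) (solve 1 (λ δ → con 1ℚ :- (con 1ℚ :- δ) := δ) refl δ) (-antimonoʳ-≤ 1ℚ 1-δ≤p)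

½≤^ℚ-near-1 : ∀ N → Σ ℚ λ p₀ → 0ℚ < p₀ × p₀ < 1ℚ × (∀ p → p₀ ≤ p → ½ ≤ p ^ℚ N)
½≤^ℚ-near-1 N = 1ℚ - δ , 0<1-δ , +-monoʳ-< 1ℚ (neg-antimono-< 0<δ) ,
  λ p 1-δ≤p → ½≤^ℚ N Nδ≤½ (≤-trans (<⇒≤ 0<1-δ) 1-δ≤p) 1-δ≤p
  where
  open +-*-Solver
  M = 1ℚ + fromℕ N
  instance
    M-positive : Positive M
    M-positive = pos+nonNeg⇒pos 1ℚ (fromℕ N) {{nonNegative (fromℕ-nonNeg N)}}
    M-nonZero : NonZero M
    M-nonZero = pos⇒nonZero M
  δ = ½ * 1/ M
  0<δ : 0ℚ < δ
  0<δ = positive⁻¹ δ {{pos*pos⇒pos ½ (1/ M) {{1/pos⇒pos M}}}}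
  δ+Nδ≡½ : δ + fromℕ N * δ ≡ ½
  δ+Nδ≡½ = begin
    δ + fromℕ N * δ ≡⟨ solve 3 (λ K h r → h :* r :+ K :* (h :* r) := h :* ((con 1ℚ :+ K) :* r))
                               refl (fromℕ N) ½ (1/ M) ⟩
    ½ * (M * 1/ M)  ≡⟨ cong (½ *_) (*-inverseʳ M) ⟩
    ½ * 1ℚ          ≡⟨ *-identityʳ ½ ⟩
    ½               ∎
    where open ≡-Reasoning
  Nδ≤½ : fromℕ N * δ ≤ ½
  Nδ≤½ = subst (fromℕ N * δ ≤_) δ+Nδ≡½ (p≤q+p (<⇒≤ 0<δ))
  δ≤½ : δ ≤ ½
  δ≤½ = subst (δ ≤_) δ+Nδ≡½ (p≤p+q (*-nonNeg (fromℕ-nonNeg N) (<⇒≤ 0<δ)))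
  0<1-δ : 0ℚ < 1ℚ - δ
  0<1-δ = <-≤-trans (positive⁻¹ ½) (-antimonoʳ-≤ 1ℚ δ≤½)

∈-sublists-self : ∀ {A : Set} (xs : List A) → xs ∈ sublists xs
∈-sublists-self []       = here refl
∈-sublists-self (x ∷ xs) = ∈-++⁺ˡ (∈-map⁺ (x ∷_) (∈-sublists-self xs))

sum-nonNeg : ∀ {A : Set} (f : A → ℚ) → (∀ a → 0ℚ ≤ f a) → ∀ xs → 0ℚ ≤ foldr _+_ 0ℚ (map f xs)
sum-nonNeg f 0≤f []       = ≤-refl
sum-nonNeg f 0≤f (x ∷ xs) = +-mono-≤ (0≤f x) (sum-nonNeg f 0≤f xs)

term≤sum : ∀ {A : Set} (f : A → ℚ) → (∀ a → 0ℚ ≤ f a) → ∀ {x xs} → x ∈ xs → f x ≤ foldr _+_ 0ℚ (map f xs)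
term≤sum f 0≤f {xs = _ ∷ xs} (here refl)  = p≤p+q (sum-nonNeg f 0≤f xs)
term≤sum f 0≤f {xs = y ∷ _}  (there x∈xs) = ≤-trans (term≤sum f 0≤f x∈xs) (p≤q+p (0≤f y))

weight-nonNeg : ∀ n {p} → 0ℚ ≤ p → p ≤ 1ℚ → ∀ G → 0ℚ ≤ weight n p G
weight-nonNeg n 0≤p p≤1 G =
  *-nonNeg (^ℚ-nonNeg (length G) 0≤p) (^ℚ-nonNeg (numPairs n ∸ length G) (-antimonoʳ-≤ 1ℚ p≤1))

weight-allEdges : ∀ n p → weight n p (allEdges n) ≡ p ^ℚ numPairs n
weight-allEdges n p = begin
  p ^ℚ numPairs n * (1ℚ - p) ^ℚ (numPairs n ∸ numPairs n)
    ≡⟨ cong ((p ^ℚ numPairs n *_) ∘ ((1ℚ - p) ^ℚ_)) (n∸n≡0 (numPairs n)) ⟩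
  p ^ℚ numPairs n * 1ℚ
    ≡⟨ *-identityʳ _ ⟩
  p ^ℚ numPairs n
    ∎
  where open ≡-Reasoning

weight≤W₂ : ∀ n {p} → 0ℚ ≤ p → p ≤ 1ℚ → ∀ {G} → G ∈ allGraphs n → isP G ≡ true → weight n p G ≤ W₂ n p
weight≤W₂ n {p} 0≤p p≤1 {G} G∈ isP-G =
  subst (λ b → (if b then weight n p G else 0ℚ) ≤ W₂ n p) isP-G (term≤sum P-weight 0≤P-weight G∈)
  where
  P-weight : Graph n → ℚ
  P-weight H = if isP H then weight n p H else 0ℚ
  0≤P-weight : ∀ H → 0ℚ ≤ P-weight H
  0≤P-weight H with isP H
  ... | true  = weight-nonNeg n 0≤p p≤1 H
  ... | false = ≤-refl

theorem6p4 : (n : ℕ) → n % 2 ≡ 1 →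
    Σ ℚ (λ p₀ → (0ℚ < p₀) × (p₀ < 1ℚ) ×
      ((p : ℚ) → p₀ ≤ p → p ≤ 1ℚ → ½ ≤ W₂ n p))
theorem6p4 n odd =
  let p₀ , 0<p₀ , p₀<1 , ½≤pᴺ = ½≤^ℚ-near-1 (numPairs n) in
  p₀ , 0<p₀ , p₀<1 , λ p p₀≤p p≤1 → begin
    ½                        ≤⟨ ½≤pᴺ p p₀≤p ⟩
    p ^ℚ numPairs n          ≡⟨ weight-allEdges n p ⟨
    weight n p (allEdges n)  ≤⟨ weight≤W₂ n (≤-trans (<⇒≤ 0<p₀) p₀≤p) p≤1
                                   (∈-sublists-self (allEdges n)) (isP-allEdges n odd) ⟩
    W₂ n p                   ∎
  where open ≤-Reasoning
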